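{- Let $\nu$ be a weight in $\mathbb R^{n+1}$ and let $\Psi:\mathcal K(\nu)\to A(\nu)$ be the bijection sending a Kostant picture with $c_{ij}$ copies of loop $[i,j]$ to the Lusztig datum $(c_{11},c_{12},\dots,c_{1n},c_{22},\dots,c_{2n},\dots,c_{nn})$. Then the two-sided dictionary order on $A(\nu)$ is a refinement of the merge order on $\mathcal K(\nu)$: if $P\le Q$ in the merge order, then $\Psi(P)\le\Psi(Q)$ in the two-sided dictionary order. The converse does not hold in general; for example, for $\nu=(1,1,-1,-1)$ there are pictures $P,Q$ with $\Psi(P)\le\Psi(Q)$ but $P\not\le Q$ in the merge order.
   Context: Let $e_1,\dots,e_{n+1}$ be the standard basis of $\mathbb R^{n+1}$ and $\alpha_{ij}=e_i-e_{j+1}$ for $1\le i\le j\le n$. A weight is $\nu=\sum c_{ij}\alpha_{ij}$ with $c_{ij}\in\mathbb N$. A Lusztig datum for $\nu$ is a tuple $\mathbf a=(a_{11},a_{12},\dots,a_{1n},a_{22},\dots,a_{2n},\dots,a_{nn})\in\mathbb N^{\binom{n+1}{2}}$ (in this fixed order, indexed linearly by $1,\dots,\binom{n+1}{2}$) with $\sum a_{ij}\alpha_{ij}=\nu$; $A(\nu)$ is the set of these. The two-sided dictionary order on $A(\nu)$: $\mathbf a\le\mathbf a'$ if there exist indices $l\le r$ (in the linear indexing) with $a'_l>a_l$, $a'_r>a_r$, and $a'_i=a_i$ for all $i<l$ and all $i>r$. A Kostant picture for $\nu$ is a decomposition $\nu=\sum c_{ij}\alpha_{ij}$, $c_{ij}\in\mathbb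 N$, viewed as a multiset of loops (intervals) $[i,j]$ on vertices $1,\dots,n$ with $c_{ij}$ copies of $[i,j]$; $\mathcal K(\nu)$ is the set of these. The merge order on $\mathcal K(\nu)$: $P$ is covered by $Q$ iff $P$ is obtained from $Q$ by merging two of its loops into one, i.e. replacing loops $[i,j]$ and $[j+1,k]$ of $Q$ by the single loop $[i,k]$; the order is the reflexive-transitive closure of this relation. -}

module Defs where

open import Data.Nat using (ℕ; zero; suc; _+_; _*_; _∸_; _≤_; _<_; _≡ᵇ_)
open import Data.Bool using (Bool; true; false; if_then_else_; _∧_)
open import Data.Fin using (Fin; toℕ)
open import Data.List using (List; []; _∷_; map; concatMap; allFin; length)
open import Data.Nat.ListAction using (sum)
open import Data.Vec using (Vec; tabulate)
open import Data.Integer using (ℤ; +_; _-_)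
open import Data.Product using (Σ; Σ-syntax; _×_; _,_; proj₁; proj₂)
open import Data.Sum using (_⊎_)
open import Relation.Binary.PropositionalEquality using (_≡_)
open import Relation.Binary.Construct.Closure.ReflexiveTransitive using (Star)

-- Vertices of the A_n Dynkin diagram are 0,1,…,n-1 (0-based; vertex k here is
-- vertex k+1 of the paper).  A loop [i , i+d] is encoded as (i , d) with
-- i : Fin n and d : Fin (n ∸ i), so that i ≤ i+d ≤ n-1.  It corresponds to
-- the positive root α = e_i - e_{i+d+1} of ℝ^{n+1} (0-based coordinates).
Loop : ℕ → Set
Loop n = Σ[ i ∈ Fin n ] Fin (n ∸ toℕ i)

start : ∀ {n} → Loop n → ℕ
start (i , d) = toℕ i

end : ∀ {n} → Loop n → ℕ
end (i , d) = toℕ i + toℕ d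

-- All loops, in the fixed linear order (1,1),(1,2),…,(1,n),(2,2),…,(n,n)
-- of the paper, i.e. lexicographic in (start, end).
allLoops : (n : ℕ) → List (Loop n)
allLoops n = concatMap (λ i → map (λ d → (i , d)) (allFin (n ∸ toℕ i))) (allFin n)

Picture : ℕ → Set
Picture n = Loop n → ℕ

weight : ∀ {n} → Picture n → Vec ℤ (suc n)
weight {n} P = tabulate λ m →
  (+ sum (map (λ ℓ → if start ℓ ≡ᵇ toℕ m then P ℓ else 0) (allLoops n)))
  - (+ sum (map (λ ℓ → if suc (end ℓ) ≡ᵇ toℕ m then P ℓ else 0) (allLoops n)))

InK : ∀ {n} → Vec ℤ (suc n) → Picture n → Set
InK ν P = weight P ≡ ν

δ : ∀ {n} → ℕ → ℕ → Loop n → ℕ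
δ a b ℓ = if (start ℓ ≡ᵇ a) ∧ (end ℓ ≡ᵇ b) then 1 else 0

-- Merge P Q : P is obtained from Q by replacing loops [i,j] and [j+1,k] of Q
-- by the single loop [i,k]  (i ≤ j < k ≤ n-1).  Stated additively:
-- P + [i,j] + [j+1,k] = Q + [i,k] as multisets (this forces Q to contain
-- both [i,j] and [j+1,k]).
Merge : ∀ {n} → Picture n → Picture n → Set
Merge {n} P Q = Σ[ i ∈ ℕ ] Σ[ j ∈ ℕ ] Σ[ k ∈ ℕ ]
  (i ≤ j) × (j < k) × (k < n) ×
  (∀ ℓ → P ℓ + δ i j ℓ + δ (suc j) k ℓ ≡ Q ℓ + δ i k ℓ)

_≤merge_ : ∀ {n} → Picture n → Picture n → Set
P ≤merge Q = Star Merge P Q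

Ψ : ∀ {n} → Picture n → List ℕ
Ψ {n} P = map P (allLoops n)

-- 0-based entry lookup (0 outside the range; only used on equal-length lists)
_!_ : List ℕ → ℕ → ℕ
[] ! k = 0
(x ∷ xs) ! zero = x
(x ∷ xs) ! suc k = xs ! k

_≤dict_ : List ℕ → List ℕ → Set
a ≤dict a' = (a ≡ a') ⊎
  ((length a ≡ length a') ×
   (Σ[ l ∈ ℕ ] Σ[ r ∈ ℕ ] (l ≤ r) × (r < length a) ×
     (a ! l < a' ! l) × (a ! r < a' ! r) ×
     (∀ i → i < l → a' ! i ≡ a ! i) ×
     (∀ i → r < i → a' ! i ≡ a ! i)))

{-# OPTIONS --safe #-}
-- A merge replaces the loops [i,j] and [j+1,k] by [i,k]. In the order in which Ψ lists loops,
-- [i,j] < [i,k] < [j+1,k], so the datum of the merged picture is smaller at the outer two of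
-- these positions and agrees with the original one before the first and after the last: a
-- single step of the two-sided dictionary order, which is transitive. Conversely, the two loops
-- of {[1,2],[2,3]} overlap instead of abutting, so nothing lies strictly below this picture in
-- the merge order, while {[1,3],[2,2]} lies below it in the dictionary order.
module Submission where

open import Defs
open import Data.Nat using (ℕ; zero; suc; _+_; _∸_; _≤_; _<_; _⊓_; _⊔_; z≤n; s≤s; _≡ᵇ_)
open import Data.Nat.Properties
open import Data.Bool using (true; false; T)
open import Data.Fin using (Fin; zero; suc; toℕ; fromℕ<)
open import Data.Fin.Properties using (toℕ-fromℕ<; toℕ<n)
open import Data.Integer using (ℤ; +_; -1ℤ)
open import Data.List using (List; _∷_; map; allFin; length)
open import Data.List.Properties using (length-map)
open import Data.List.Relation.Unary.All as All using (All; []; _∷_)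
import Data.List.Relation.Unary.All.Properties as All
open import Data.List.Relation.Unary.Any using (here; there; index)
open import Data.List.Relation.Unary.AllPairs using (AllPairs; _∷_)
import Data.List.Relation.Unary.AllPairs.Properties as AllPairs
open import Data.List.Membership.Propositional using (_∈_; lose)
open import Data.List.Membership.Propositional.Properties using (∈-map⁺; ∈-concatMap⁺; ∈-allFin)
open import Data.Product using (Σ-syntax; _×_; _,_; proj₁; proj₂)
open import Data.Product.Relation.Binary.Lex.Strict using (×-Lex; ×-transitive; ×-asymmetric)
open import Data.Sum using (inj₁; inj₂)
open import Data.Vec using (Vec; []; _∷_)
open import Function using (_∘_)
open import Level using (0ℓ)
open import Relation.Binary using (Rel; Transitive; Asymmetric; tri<; tri≈; tri>)
open import Relation.Binary.PropositionalEquality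
open import Relation.Binary.Construct.Closure.ReflexiveTransitive using (Star; ε; _◅_; fold)
open import Relation.Nullary using (¬_; contradiction)

private
  variable
    A : Set
    a b c : List ℕ
    l₁ l₂ : ℕ

record IncreasesFirstAt (a a' : List ℕ) (l : ℕ) : Set where
  constructor increasesFirstAt
  field
    increase : a ! l < a' ! l
    agreeBefore : ∀ i → i < l → a' ! i ≡ a ! i

record IncreasesLastAt (a a' : List ℕ) (r : ℕ) : Set where
  constructor increasesLastAt
  field
    increase : a ! r < a' ! r
    agreeAfter : ∀ i → r < i → a' ! i ≡ a ! i

≤dict-intro : ∀ {a a' l r} → length a ≡ length a' → l ≤ r → r < length a →
              IncreasesFirstAt a a' l → IncreasesLastAt a a' r → a ≤dict a'
≤dict-intro len l≤r r<len (increasesFirstAt <ₗ ≡ₗ) (increasesLastAt <ᵣ ≡ᵣ) =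
  inj₂ (len , _ , _ , l≤r , r<len , <ₗ , <ᵣ , ≡ₗ , ≡ᵣ)

increasesFirstAt-trans : IncreasesFirstAt a b l₁ → IncreasesFirstAt b c l₂ →
                         IncreasesFirstAt a c (l₁ ⊓ l₂)
increasesFirstAt-trans {a = a} {l₁ = l₁} {c = c} {l₂ = l₂}
  (increasesFirstAt a<b b≡a) (increasesFirstAt b<c c≡b) =
  increasesFirstAt increase agree
  where
  agree : ∀ i → i < l₁ ⊓ l₂ → c ! i ≡ a ! i
  agree i i<l = trans (c≡b i (m<n⊓o⇒m<o l₁ l₂ i<l)) (b≡a i (m<n⊓o⇒m<n l₁ l₂ i<l))
  increase : a ! (l₁ ⊓ l₂) < c ! (l₁ ⊓ l₂)
  increase with <-cmp l₁ l₂
  ... | tri< l₁<l₂ _ _ rewrite m≤n⇒m⊓n≡m (<⇒≤ l₁<l₂) = subst (a ! l₁ <_) (sym (c≡b l₁ l₁<l₂)) a<b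
  ... | tri≈ _ refl _ rewrite ⊓-idem l₁ = <-trans a<b b<c
  ... | tri> _ _ l₂<l₁ rewrite m≥n⇒m⊓n≡n (<⇒≤ l₂<l₁) = subst (_< c ! l₂) (b≡a l₂ l₂<l₁) b<c

increasesLastAt-trans : IncreasesLastAt a b l₁ → IncreasesLastAt b c l₂ →
                        IncreasesLastAt a c (l₁ ⊔ l₂)
increasesLastAt-trans {a = a} {l₁ = l₁} {c = c} {l₂ = l₂}
  (increasesLastAt a<b b≡a) (increasesLastAt b<c c≡b) =
  increasesLastAt increase agree
  where
  agree : ∀ i → l₁ ⊔ l₂ < i → c ! i ≡ a ! i
  agree i l<i = trans (c≡b i (m⊔n<o⇒n<o l₁ l₂ l<i)) (b≡a i (m⊔n<o⇒m<o l₁ l₂ l<i))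
  increase : a ! (l₁ ⊔ l₂) < c ! (l₁ ⊔ l₂)
  increase with <-cmp l₁ l₂
  ... | tri< l₁<l₂ _ _ rewrite m≤n⇒m⊔n≡n (<⇒≤ l₁<l₂) = subst (_< c ! l₂) (b≡a l₂ l₁<l₂) b<c
  ... | tri≈ _ refl _ rewrite ⊔-idem l₁ = <-trans a<b b<c
  ... | tri> _ _ l₂<l₁ rewrite m≥n⇒m⊔n≡m (<⇒≤ l₂<l₁) = subst (a ! l₁ <_) (sym (c≡b l₁ l₂<l₁)) a<b

≤dict-trans : a ≤dict b → b ≤dict c → a ≤dict c
≤dict-trans (inj₁ refl) b≤c = b≤c
≤dict-trans a≤b (inj₁ refl) = a≤b
≤dict-trans {b = b} (inj₂ (len₁ , l₁ , r₁ , l₁≤r₁ , r₁<len , <ₗ₁ , <ᵣ₁ , ≡ₗ₁ , ≡ᵣ₁))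
                        (inj₂ (len₂ , l₂ , r₂ , _     , r₂<len , <ₗ₂ , <ᵣ₂ , ≡ₗ₂ , ≡ᵣ₂)) =
  ≤dict-intro (trans len₁ len₂)
    (≤-trans (m⊓n≤m l₁ l₂) (≤-trans l₁≤r₁ (m≤m⊔n r₁ r₂)))
    (⊔-pres-<m r₁<len (subst (r₂ <_) (sym len₁) r₂<len))
    (increasesFirstAt-trans {b = b} (increasesFirstAt <ₗ₁ ≡ₗ₁) (increasesFirstAt <ₗ₂ ≡ₗ₂))
    (increasesLastAt-trans {b = b} (increasesLastAt <ᵣ₁ ≡ᵣ₁) (increasesLastAt <ᵣ₂ ≡ᵣ₂))

module _ {_≺_ : Rel A 0ℓ} where

  sorted-index<⇒≺ : ∀ {xs x y} → AllPairs _≺_ xs → (x∈ : x ∈ xs) (y∈ : y ∈ xs) →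
                    toℕ (index x∈) < toℕ (index y∈) → x ≺ y
  sorted-index<⇒≺ (x≺ ∷ _) (here refl) (there y∈) _ = All.lookup x≺ y∈
  sorted-index<⇒≺ (_ ∷ sorted) (there x∈) (there y∈) (s≤s x<y) = sorted-index<⇒≺ sorted x∈ y∈ x<y

  module _ (f g : A → ℕ) where

    map-!-cong : ∀ {xs} → All (λ y → g y ≡ f y) xs → ∀ i → map g xs ! i ≡ map f xs ! i
    map-!-cong [] _ = refl
    map-!-cong (g≡f ∷ _) zero = g≡f
    map-!-cong (_ ∷ g≗f) (suc i) = map-!-cong g≗f i

    increasesFirstAt-map : ∀ {xs x} → AllPairs _≺_ xs → (x∈ : x ∈ xs) → f x < g x →
                           (∀ y → y ≺ x → g y ≡ f y) →
                           IncreasesFirstAt (map f xs) (map g xs) (toℕ (index x∈))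
    increasesFirstAt-map (_ ∷ _) (here refl) fx<gx _ = increasesFirstAt fx<gx λ _ ()
    increasesFirstAt-map {y ∷ xs} (y≺ ∷ sorted) (there x∈) fx<gx agree =
      increasesFirstAt (IncreasesFirstAt.increase tail) λ where
        zero _ → agree y (All.lookup y≺ x∈)
        (suc i) (s≤s i<l) → IncreasesFirstAt.agreeBefore tail i i<l
      where
      tail : IncreasesFirstAt (map f xs) (map g xs) (toℕ (index x∈))
      tail = increasesFirstAt-map sorted x∈ fx<gx agree

    increasesLastAt-map : ∀ {xs x} → AllPairs _≺_ xs → (x∈ : x ∈ xs) → f x < g x →
                          (∀ y → x ≺ y → g y ≡ f y) →
                          IncreasesLastAt (map f xs) (map g xs) (toℕ (index x∈))
    increasesLastAt-map (x≺ ∷ _) (here refl) fx<gx agree =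
      increasesLastAt fx<gx λ where
        (suc i) _ → map-!-cong (All.map (agree _) x≺) i
    increasesLastAt-map {_ ∷ xs} (_ ∷ sorted) (there x∈) fx<gx agree =
      increasesLastAt (IncreasesLastAt.increase tail) λ where
        (suc i) (s≤s r<i) → IncreasesLastAt.agreeAfter tail i r<i
      where
      tail : IncreasesLastAt (map f xs) (map g xs) (toℕ (index x∈))
      tail = increasesLastAt-map sorted x∈ fx<gx agree

    ≤dict-window : ∀ {xs x y} → AllPairs _≺_ xs → x ∈ xs → y ∈ xs → ¬ y ≺ x →
                   f x < g x → f y < g y →
                   (∀ z → z ≺ x → g z ≡ f z) → (∀ z → y ≺ z → g z ≡ f z) →
                   map f xs ≤dict map g xs
    ≤dict-window {xs} sorted x∈ y∈ y⊀x fx<gx fy<gy before after =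
      ≤dict-intro (trans (length-map f xs) (sym (length-map g xs)))
        (≮⇒≥ (y⊀x ∘ sorted-index<⇒≺ sorted y∈ x∈))
        (subst (_ <_) (sym (length-map f xs)) (toℕ<n (index y∈)))
        (increasesFirstAt-map sorted x∈ fx<gx before)
        (increasesLastAt-map sorted y∈ fy<gy after)

_<ₗₑₓ_ : Rel (ℕ × ℕ) 0ℓ
_<ₗₑₓ_ = ×-Lex _≡_ _<_ _<_

<ₗₑₓ-trans : Transitive _<ₗₑₓ_
<ₗₑₓ-trans = ×-transitive {_<₂_ = _<_} isEquivalence <-resp₂-≡ <-trans <-trans

<ₗₑₓ-asym : Asymmetric _<ₗₑₓ_
<ₗₑₓ-asym = ×-asymmetric {_<₂_ = _<_} sym <-resp₂-≡ <-asym <-asym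

<ₗₑₓ⇒≢ : ∀ {p q} → p <ₗₑₓ q → p ≢ q
<ₗₑₓ⇒≢ p<p refl = <ₗₑₓ-asym p<p p<p

≡ᵇ-refl : ∀ m → (m ≡ᵇ m) ≡ true
≡ᵇ-refl zero = refl
≡ᵇ-refl (suc m) = ≡ᵇ-refl m

module _ {n : ℕ} where

  position : Loop n → ℕ × ℕ
  position ℓ = start ℓ , end ℓ

  _≺_ : Rel (Loop n) 0ℓ
  ℓ ≺ ℓ' = position ℓ <ₗₑₓ position ℓ'

  allLoops-sorted : AllPairs _≺_ (allLoops n)
  allLoops-sorted = AllPairs.concat⁺
    (All.map⁺ (All.universal block-sorted (allFin n)))
    (AllPairs.map⁺ (AllPairs.tabulate⁺-< λ i<i' →
       All.map⁺ (All.universal (λ _ → All.map⁺ (All.universal (λ _ → inj₁ i<i') _)) _)))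
    where
    block-sorted : ∀ i → AllPairs _≺_ (map (i ,_) (allFin (n ∸ toℕ i)))
    block-sorted i =
      AllPairs.map⁺ (AllPairs.tabulate⁺-< λ d<d' → inj₂ (refl , +-monoʳ-< (toℕ i) d<d'))

  ∈-allLoops : ∀ ℓ → ℓ ∈ allLoops n
  ∈-allLoops (i , d) = ∈-concatMap⁺ _ (lose (∈-allFin i) (∈-map⁺ (i ,_) (∈-allFin d)))

  loopAt : ∀ {i j} → i ≤ j → j < n → Σ[ ℓ ∈ Loop n ] position ℓ ≡ (i , j)
  loopAt {i} {j} i≤j j<n =
    (s , d) , cong₂ _,_ s≡i (trans (cong (λ m → toℕ s + m) d≡j∸s) (m+[n∸m]≡n s≤j))
    where
    i<n : i < n
    i<n = ≤-<-trans i≤j j<n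
    s : Fin n
    s = fromℕ< i<n
    s≡i : toℕ s ≡ i
    s≡i = toℕ-fromℕ< i<n
    s≤j : toℕ s ≤ j
    s≤j = subst (_≤ j) (sym s≡i) i≤j
    d : Fin (n ∸ toℕ s)
    d = fromℕ< (∸-monoˡ-< j<n s≤j)
    d≡j∸s : toℕ d ≡ j ∸ toℕ s
    d≡j∸s = toℕ-fromℕ< (∸-monoˡ-< j<n s≤j)

  δ-on : ∀ {a b} {ℓ : Loop n} → position ℓ ≡ (a , b) → δ a b ℓ ≡ 1
  δ-on {ℓ = ℓ} refl rewrite ≡ᵇ-refl (start ℓ) | ≡ᵇ-refl (end ℓ) = refl

  δ-off : ∀ {a b p} {ℓ : Loop n} → position ℓ ≡ p → p ≢ (a , b) → δ a b ℓ ≡ 0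
  δ-off {a} {b} {ℓ = ℓ} refl ℓ≢ab with start ℓ ≡ᵇ a in s≡a | end ℓ ≡ᵇ b in e≡b
  ... | false | _     = refl
  ... | true  | false = refl
  ... | true  | true  =
    contradiction (cong₂ _,_ (≡ᵇ⇒≡ _ _ (subst T (sym s≡a) _)) (≡ᵇ⇒≡ _ _ (subst T (sym e≡b) _))) ℓ≢ab

module MergeStep {n} {P Q : Picture n} {i j k : ℕ} (i≤j : i ≤ j) (j<k : j < k) (k<n : k < n)
                 (merge : ∀ ℓ → P ℓ + δ i j ℓ + δ (suc j) k ℓ ≡ Q ℓ + δ i k ℓ) where

  -- The δ-values are moved to the front so that, once they are literals, both sides compute.
  merge-at : ∀ ℓ {u v w} → δ i j ℓ ≡ u → δ (suc j) k ℓ ≡ v → δ i k ℓ ≡ w → v + (u + P ℓ) ≡ w + Q ℓ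
  merge-at ℓ refl refl refl = begin
    δ (suc j) k ℓ + (δ i j ℓ + P ℓ)  ≡⟨ +-comm (δ (suc j) k ℓ) _ ⟩
    δ i j ℓ + P ℓ + δ (suc j) k ℓ    ≡⟨ cong (λ m → m + δ (suc j) k ℓ) (+-comm (δ i j ℓ) (P ℓ)) ⟩
    P ℓ + δ i j ℓ + δ (suc j) k ℓ    ≡⟨ merge ℓ ⟩
    Q ℓ + δ i k ℓ                    ≡⟨ +-comm (Q ℓ) _ ⟩
    δ i k ℓ + Q ℓ                    ∎
    where open ≡-Reasoning

  ij<ik : (i , j) <ₗₑₓ (i , k)
  ij<ik = inj₂ (refl , j<k)

  ik<sjk : (i , k) <ₗₑₓ (suc j , k)
  ik<sjk = inj₁ (s≤s i≤j)

  ij<sjk : (i , j) <ₗₑₓ (suc j , k)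
  ij<sjk = <ₗₑₓ-trans ij<ik ik<sjk

  unchanged : ∀ ℓ → position ℓ ≢ (i , j) → position ℓ ≢ (i , k) → position ℓ ≢ (suc j , k) →
              Q ℓ ≡ P ℓ
  unchanged ℓ ≢ij ≢ik ≢sjk = sym (merge-at ℓ (δ-off refl ≢ij) (δ-off refl ≢sjk) (δ-off refl ≢ik))

  left : Loop n
  left = proj₁ (loopAt i≤j (<-trans j<k k<n))

  left-position : position left ≡ (i , j)
  left-position = proj₂ (loopAt i≤j (<-trans j<k k<n))

  right : Loop n
  right = proj₁ (loopAt j<k k<n)

  right-position : position right ≡ (suc j , k)
  right-position = proj₂ (loopAt j<k k<n)

  left-increases : P left < Q left
  left-increases = ≤-reflexive
    (merge-at left (δ-on left-position) (δ-off left-position (<ₗₑₓ⇒≢ ij<sjk))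
                   (δ-off left-position (<ₗₑₓ⇒≢ ij<ik)))

  right-increases : P right < Q right
  right-increases = ≤-reflexive
    (merge-at right (δ-off right-position (≢-sym (<ₗₑₓ⇒≢ ij<sjk))) (δ-on right-position)
                    (δ-off right-position (≢-sym (<ₗₑₓ⇒≢ ik<sjk))))

  unchanged-before-left : ∀ ℓ → ℓ ≺ left → Q ℓ ≡ P ℓ
  unchanged-before-left ℓ ℓ≺left =
    unchanged ℓ (<ₗₑₓ⇒≢ ℓ<ij) (<ₗₑₓ⇒≢ (<ₗₑₓ-trans ℓ<ij ij<ik)) (<ₗₑₓ⇒≢ (<ₗₑₓ-trans ℓ<ij ij<sjk))
    where
    ℓ<ij : position ℓ <ₗₑₓ (i , j)
    ℓ<ij = subst (position ℓ <ₗₑₓ_) left-position ℓ≺left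

  unchanged-after-right : ∀ ℓ → right ≺ ℓ → Q ℓ ≡ P ℓ
  unchanged-after-right ℓ right≺ℓ =
    unchanged ℓ (≢-sym (<ₗₑₓ⇒≢ (<ₗₑₓ-trans ij<sjk sjk<ℓ)))
                (≢-sym (<ₗₑₓ⇒≢ (<ₗₑₓ-trans ik<sjk sjk<ℓ)))
                (≢-sym (<ₗₑₓ⇒≢ sjk<ℓ))
    where
    sjk<ℓ : (suc j , k) <ₗₑₓ position ℓ
    sjk<ℓ = subst (_<ₗₑₓ position ℓ) right-position right≺ℓ

  left≺right : left ≺ right
  left≺right = subst₂ _<ₗₑₓ_ (sym left-position) (sym right-position) ij<sjk

  left-adjacent-right : suc (end left) ≡ start right
  left-adjacent-right = trans (cong (suc ∘ proj₂) left-position) (sym (cong proj₁ right-position))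

  Ψ-≤dict : Ψ P ≤dict Ψ Q
  Ψ-≤dict = ≤dict-window P Q allLoops-sorted (∈-allLoops left) (∈-allLoops right)
              (<ₗₑₓ-asym left≺right) left-increases right-increases
              unchanged-before-left unchanged-after-right

module _ {n : ℕ} {P Q : Picture n} where

  merge⇒Ψ-≤dict : Merge P Q → Ψ P ≤dict Ψ Q
  merge⇒Ψ-≤dict (_ , _ , _ , i≤j , j<k , k<n , merge) = MergeStep.Ψ-≤dict i≤j j<k k<n merge

  merge-consumes-adjacent-loops : Merge P Q →
    Σ[ ℓ ∈ Loop n ] Σ[ ℓ' ∈ Loop n ] suc (end ℓ) ≡ start ℓ' × P ℓ < Q ℓ × P ℓ' < Q ℓ'
  merge-consumes-adjacent-loops (_ , _ , _ , i≤j , j<k , k<n , merge) =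
    left , right , left-adjacent-right , left-increases , right-increases
    where open MergeStep i≤j j<k k<n merge

≤merge⇒Ψ-≤dict : ∀ {n} {P Q : Picture n} → P ≤merge Q → Ψ P ≤dict Ψ Q
≤merge⇒Ψ-≤dict = fold (λ P Q → Ψ P ≤dict Ψ Q) (≤dict-trans ∘ merge⇒Ψ-≤dict) (inj₁ refl)

sink⇒Star≡ : ∀ {R : Rel A 0ℓ} {x y} → (∀ {z} → ¬ R z y) → Star R x y → x ≡ y
sink⇒Star≡ _ ε = refl
sink⇒Star≡ no-step (r ◅ rs) with refl ← sink⇒Star≡ no-step rs = contradiction r no-step

-- The pictures {[1,2],[2,3]} and {[1,3],[2,2]} in the paper's 1-based notation.
overlapping : Picture 3
overlapping (zero , suc zero) = 1
overlapping (suc zero , suc zero) = 1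
overlapping _ = 0

nested : Picture 3
nested (zero , suc (suc zero)) = 1
nested (suc zero , zero) = 1
nested _ = 0

overlapping-support : ∀ ℓ → 0 < overlapping ℓ → start ℓ ≤ 1 × 1 ≤ end ℓ
overlapping-support (zero , suc zero) _ = z≤n , s≤s z≤n
overlapping-support (suc zero , suc zero) _ = s≤s z≤n , s≤s z≤n

overlapping-unmergeable : ∀ {P} → ¬ Merge P overlapping
overlapping-unmergeable merge with merge-consumes-adjacent-loops merge
... | ℓ , ℓ' , adjacent , Pℓ<Qℓ , Pℓ'<Qℓ' = 1+n≰n (begin
  2            ≤⟨ s≤s (proj₂ (overlapping-support ℓ (≤-<-trans z≤n Pℓ<Qℓ))) ⟩
  suc (end ℓ)  ≡⟨ adjacent ⟩
  start ℓ'     ≤⟨ proj₁ (overlapping-support ℓ' (≤-<-trans z≤n Pℓ'<Qℓ')) ⟩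
  1            ∎)
  where open ≤-Reasoning hiding (start)

nested-≰merge-overlapping : ¬ (nested ≤merge overlapping)
nested-≰merge-overlapping = nested≢overlapping ∘ sink⇒Star≡ overlapping-unmergeable
  where
  nested≢overlapping : nested ≢ overlapping
  nested≢overlapping eq with cong (λ P → P (zero , suc zero)) eq
  ... | ()

nested-≤dict-overlapping : Ψ nested ≤dict Ψ overlapping
nested-≤dict-overlapping =
  ≤dict-intro refl (s≤s z≤n) (s≤s (s≤s (s≤s (s≤s (s≤s z≤n)))))
    (increasesFirstAt (s≤s z≤n) λ where
      zero _ → refl
      (suc _) (s≤s ()))
    (increasesLastAt (s≤s z≤n) λ where _ (s≤s (s≤s (s≤s (s≤s (s≤s _))))) → refl)

theorem3p6 : (∀ (n : ℕ) (ν : Vec ℤ (suc n)) (P Q : Picture n) →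
    InK ν P → InK ν Q → P ≤merge Q → Ψ P ≤dict Ψ Q)
    ×
    (Σ[ P ∈ Picture 3 ] Σ[ Q ∈ Picture 3 ]
      InK (+ 1 ∷ + 1 ∷ -1ℤ ∷ -1ℤ ∷ []) P ×
      InK (+ 1 ∷ + 1 ∷ -1ℤ ∷ -1ℤ ∷ []) Q ×
      (Ψ P ≤dict Ψ Q) × ¬ (P ≤merge Q))
theorem3p6 =
  (λ _ _ _ _ _ _ → ≤merge⇒Ψ-≤dict) ,
  (nested , overlapping , refl , refl , nested-≤dict-overlapping , nested-≰merge-overlapping)
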